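{- Let $G$ be a finite (not necessarily connected) chordal graph, let $I$ be an arbitrary independent set of $G$, and let $k$ be the number of connected components of $G$. Then for every execution of \textsc{Greedy} on $G$ (with any tie-breaking), the numbers of $0$-moves and $1$-moves with respect to $I$ satisfy $m_0+m_1\geq k$.
   Context: Graphs are finite, simple, undirected; a graph is chordal if every simple cycle on at least 4 vertices has two non-consecutive adjacent vertices. \textsc{Greedy}: start with $S=\emptyset$, $G_1=G$; at step $t$, while $G_t$ is nonempty, choose any vertex $v_t$ of minimum degree in $G_t$ (ties broken arbitrarily), add it to $S$, and set $G_{t+1}=G_t\setminus N_{G_t}[v_t]$. Given an independent set $I$ of $G$, let $I_1=I$ and $I_{t+1}=I_t\setminus N_{G_t}[v_t]$ (the part of $I$ still available). Step $t$ is a $j$-move with respect to $I$ if $|N_{G_t}[v_t]\cap I_t|=j$, and $m_j$ denotes the total number of $j$-moves in the execution. -}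

module Defs where

open import Data.Nat using (ℕ; zero; suc; _+_; _≤_; _%_)
open import Data.Bool using (Bool; true; false)
open import Data.Fin using (Fin; toℕ)
open import Data.Fin.Subset using (Subset; _∈_; _∩_; _∪_; _─_; ⁅_⁆; ∣_∣; ⊤; ⊥)
open import Data.Vec using (tabulate)
open import Data.List using (List; []; _∷_)
open import Data.Product using (Σ; ∃; _×_; _,_)
open import Function.Definitions using (Injective; Surjective)
open import Relation.Binary.PropositionalEquality using (_≡_; _≢_)
open import Relation.Binary.Construct.Closure.ReflexiveTransitive using (Star)
open import Relation.Nullary using (¬_)
open import Relation.Nullary.Decidable using (⌊_⌋)
open import Data.Nat using (_≟_)

record Graph (n : ℕ) : Set where
  field
    adj    : Fin n → Fin n → Bool
    sym    : ∀ u v → adj u v ≡ adj v u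
    irrefl : ∀ v → adj v v ≡ false
open Graph public

Edge : ∀ {n} → Graph n → Fin n → Fin n → Set
Edge G u v = adj G u v ≡ true

Nbr : ∀ {n} → Graph n → Fin n → Subset n
Nbr G v = tabulate (adj G v)

ClosedNbrIn : ∀ {n} → Graph n → Subset n → Fin n → Subset n
ClosedNbrIn G A v = A ∩ (⁅ v ⁆ ∪ Nbr G v)

degIn : ∀ {n} → Graph n → Subset n → Fin n → ℕ
degIn G A v = ∣ A ∩ Nbr G v ∣

Independent : ∀ {n} → Graph n → Subset n → Set
Independent G I = ∀ u v → u ∈ I → v ∈ I → ¬ Edge G u v

-- Chordality: every simple cycle on m ≥ 4 vertices has a chord.
Consecutive : ∀ m → Fin (4 + m) → Fin (4 + m) → Set
Consecutive m i j = toℕ j ≡ suc (toℕ i) % (4 + m)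

Chordal : ∀ {n} → Graph n → Set
Chordal {n} G =
  ∀ (m : ℕ) (c : Fin (4 + m) → Fin n) →
  Injective _≡_ _≡_ c →
  (∀ i j → Consecutive m i j → Edge G (c i) (c j)) →
  Σ (Fin (4 + m)) λ i → Σ (Fin (4 + m)) λ j →
    ¬ Consecutive m i j × ¬ Consecutive m j i × Edge G (c i) (c j)

Connected : ∀ {n} → Graph n → Fin n → Fin n → Set
Connected G = Star (Edge G)

HasComponents : ∀ {n} → Graph n → ℕ → Set
HasComponents {n} G k =
  Σ (Fin n → Fin k) λ comp →
    Surjective _≡_ _≡_ comp ×
    (∀ u v → (comp u ≡ comp v → Connected G u v) × (Connected G u v → comp u ≡ comp v))

data GreedyRun {n} (G : Graph n) : Subset n → List (Fin n) → Set where
  done : ∀ {A} → (∀ u → ¬ (u ∈ A)) → GreedyRun G A []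
  step : ∀ {A v vs} → v ∈ A →
         (∀ u → u ∈ A → degIn G A v ≤ degIn G A u) →
         GreedyRun G (A ─ ClosedNbrIn G A v) vs →
         GreedyRun G A (v ∷ vs)

-- Number of j-moves with respect to the available part J (= I_t) of I,
-- along the sequence of chosen vertices, starting from G_t = G[A].
moves : ∀ {n} → Graph n → ℕ → Subset n → Subset n → List (Fin n) → ℕ
moves G j A J [] = 0
moves G j A J (v ∷ vs) =
  (if ⌊ ∣ ClosedNbrIn G A v ∩ J ∣ ≟ j ⌋ then 1 else 0)
  + moves G j (A ─ ClosedNbrIn G A v) (J ─ ClosedNbrIn G A v) vs
  where open import Data.Bool using (if_then_else_)

{-# OPTIONS --safe #-}
module Submission where

-- A Greedy step lowers the number of components of the remaining graph G[A] by at most one, and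
-- only when the closed neighbourhood N[v] is a whole component of G[A]: otherwise some w outside
-- N[v] is joined to it and takes over as representative of v's component. At such a step every
-- vertex of N[v] has all its neighbours in N[v] and, v having minimum degree, at least ∣ N[v] ∣ - 1
-- of them, so N[v] is a clique and meets the independent set at most once: the step is a 0- or
-- 1-move. Since each of the k components must eventually disappear, there are at least k such steps.

open import Defs
open import Data.Nat using (ℕ; _+_; _≤_)
open import Data.Fin using (Fin)
open import Data.Fin.Subset using (Subset; ⊤)
open import Data.List using (List)

open import Algebra.Properties.CommutativeSemigroup using (interchange)
open import Data.Bool using (true; false; if_then_else_)
import Data.Bool as Bool
open import Data.Empty using (⊥-elim)
open import Data.Fin.Properties using (any?; suc-injective)
import Data.Fin.Properties as Fin
open import Data.Fin.Subset using (_∈_; _∉_; _∩_; _─_; _-_; ⁅_⁆; ∣_∣; _⊆_; Empty)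
open import Data.Fin.Subset.Properties
  using (_∈?_; ∈⊤; ∣⁅x⁆∣≡1; Empty-unique; ∣⊥∣≡0; x∈p∩q⁺; x∈p∩q⁻; x∈p∪q⁻; x∈⁅y⁆⇒x≡y;
         x∉⁅y⁆⇒x≢y; x∈p∧x∉q⇒x∈p─q; x∈p∧x≢y⇒x∈p-y; p─q⊆p; p⊆q⇒∣p∣≤∣q∣; x∈p⇒∣p-x∣<∣p∣)
open import Data.List using ([]; _∷_; length; map; filter; tabulate)
open import Data.List.Properties using (length-map; length-tabulate; filter-all)
open import Data.List.Relation.Unary.All as All using (All; []; _∷_)
import Data.List.Relation.Unary.All.Properties as All
open import Data.List.Relation.Unary.AllPairs as AllPairs using (AllPairs; []; _∷_)
import Data.List.Relation.Unary.AllPairs.Properties as AllPairs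
open import Data.Nat using (suc; _<_; z≤n; s≤s; _≟_)
open import Data.Nat.Properties
  using (≤-reflexive; ≤-trans; <-irrefl; <-≤-trans; n≤1+n; m≤n+m; +-suc; +-comm; +-monoʳ-≤; +-mono-≤;
         +-commutativeSemigroup; module ≤-Reasoning)
open import Data.Product using (∃; _×_; _,_; proj₁; proj₂)
open import Data.Sum using (_⊎_; inj₁; inj₂)
open import Data.Vec using ([]; _∷_; here; there)
open import Data.Vec.Properties using (lookup∘tabulate; lookup⇒[]=; []=⇒lookup)
open import Relation.Binary.Construct.Closure.ReflexiveTransitive as Star using (Star; ε; _◅_; _◅◅_)
open import Relation.Binary.PropositionalEquality using (_≡_; _≢_; refl; trans; cong; subst; ≢-sym)
import Relation.Binary.PropositionalEquality as ≡
open import Relation.Nullary using (¬_; Dec; yes; no)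
open import Relation.Nullary.Decidable using (⌊_⌋; _×-dec_; decidable-stable)
open import Relation.Unary using (Pred; Decidable)
open import Relation.Unary.Properties using (∁?)

x∈p─q⇒x∉q : ∀ {m} {p q : Subset m} {x} → x ∈ p ─ q → x ∉ q
x∈p─q⇒x∉q {p = _ ∷ _} {_ ∷ _} (there x∈p─q) (there x∈q) = x∈p─q⇒x∉q x∈p─q x∈q
x∈p─q⇒x∉q {p = false ∷ _} {_ ∷ _} () here
x∈p─q⇒x∉q {p = true ∷ _} {true ∷ _} () here

∣p∣≤∣p─q∣+∣q∣ : ∀ {m} (p q : Subset m) → ∣ p ∣ ≤ ∣ p ─ q ∣ + ∣ q ∣
∣p∣≤∣p─q∣+∣q∣ []          []          = z≤n
∣p∣≤∣p─q∣+∣q∣ (true  ∷ p) (false ∷ q) = s≤s (∣p∣≤∣p─q∣+∣q∣ p q)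
∣p∣≤∣p─q∣+∣q∣ (false ∷ p) (false ∷ q) = ∣p∣≤∣p─q∣+∣q∣ p q
∣p∣≤∣p─q∣+∣q∣ (true  ∷ p) (true  ∷ q) =
  ≤-trans (s≤s (∣p∣≤∣p─q∣+∣q∣ p q)) (≤-reflexive (≡.sym (+-suc ∣ p ─ q ∣ ∣ q ∣)))
∣p∣≤∣p─q∣+∣q∣ (false ∷ p) (true  ∷ q) =
  ≤-trans (∣p∣≤∣p─q∣+∣q∣ p q) (+-monoʳ-≤ ∣ p ─ q ∣ (n≤1+n ∣ q ∣))

∣p∣≤1+∣p-x∣ : ∀ {m} (p : Subset m) x → ∣ p ∣ ≤ suc ∣ p - x ∣
∣p∣≤1+∣p-x∣ p x = ≤-trans (∣p∣≤∣p─q∣+∣q∣ p ⁅ x ⁆)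
  (≤-reflexive (trans (cong (∣ p - x ∣ +_) (∣⁅x⁆∣≡1 x)) (+-comm ∣ p - x ∣ 1)))

subsingleton⇒∣p∣≤1 : ∀ {m} (p : Subset m) → (∀ {x y} → x ∈ p → y ∈ p → x ≡ y) → ∣ p ∣ ≤ 1
subsingleton⇒∣p∣≤1 []          _      = z≤n
subsingleton⇒∣p∣≤1 (false ∷ p) unique =
  subsingleton⇒∣p∣≤1 p (λ x∈p y∈p → suc-injective (unique (there x∈p) (there y∈p)))
subsingleton⇒∣p∣≤1 {suc m} (true  ∷ p) unique =
  s≤s (≤-reflexive (trans (cong ∣_∣ (Empty-unique p-empty)) (∣⊥∣≡0 m)))
  where
  p-empty : Empty p
  p-empty (x , x∈p) with unique (there x∈p) here
  ... | ()

length≤1+length-filter∁ : ∀ {a ℓ} {A : Set a} {P : Pred A ℓ} (P? : Decidable P) {xs : List A} →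
                         AllPairs (λ x y → P x → ¬ P y) xs →
                         length xs ≤ suc (length (filter (∁? P?) xs))
length≤1+length-filter∁ P? {[]}     []           = z≤n
length≤1+length-filter∁ P? {x ∷ xs} (x⊥xs ∷ xs!) with P? x
... | yes px = s≤s (≤-reflexive (cong length (≡.sym (filter-all (∁? P?) (All.map (λ f → f px) x⊥xs)))))
... | no  _  = s≤s (length≤1+length-filter∁ P? xs!)

isMove : ℕ → ℕ → ℕ
isMove j c = if ⌊ c ≟ j ⌋ then 1 else 0

c≤1⇒isMove₀+isMove₁≡1 : ∀ c → c ≤ 1 → isMove 0 c + isMove 1 c ≡ 1
c≤1⇒isMove₀+isMove₁≡1 0 _ = refl
c≤1⇒isMove₀+isMove₁≡1 1 _ = refl
c≤1⇒isMove₀+isMove₁≡1 (suc (suc _)) (s≤s ())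

module _ {n} (G : Graph n) where

  EdgeIn : Subset n → Fin n → Fin n → Set
  EdgeIn A u v = u ∈ A × v ∈ A × Edge G u v

  ConnectedIn : Subset n → Fin n → Fin n → Set
  ConnectedIn A = Star (EdgeIn A)

  Apart : Subset n → Fin n → Fin n → Set
  Apart A x y = ¬ ConnectedIn A x y

  -- Witnesses that G[A] has at least length R components.
  Scattered : Subset n → List (Fin n) → Set
  Scattered A R = All (_∈ A) R × AllPairs (Apart A) R

  Edge-sym : ∀ {u v} → Edge G u v → Edge G v u
  Edge-sym {u} {v} e = trans (Graph.sym G v u) e

  ¬Edge-refl : ∀ {u} → ¬ Edge G u u
  ¬Edge-refl {u} e with trans (≡.sym e) (Graph.irrefl G u)
  ... | ()

  ConnectedIn-sym : ∀ {A x y} → ConnectedIn A x y → ConnectedIn A y x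
  ConnectedIn-sym ε                     = ε
  ConnectedIn-sym ((x∈A , y∈A , e) ◅ c) = ConnectedIn-sym c ◅◅ ((y∈A , x∈A , Edge-sym e) ◅ ε)

  ConnectedIn-mono : ∀ {A B x y} → B ⊆ A → ConnectedIn B x y → ConnectedIn A x y
  ConnectedIn-mono B⊆A = Star.map (λ (x∈B , y∈B , e) → B⊆A x∈B , B⊆A y∈B , e)

  Independent-mono : ∀ {I J} → J ⊆ I → Independent G I → Independent G J
  Independent-mono J⊆I I-indep u v u∈J v∈J = I-indep u v (J⊆I u∈J) (J⊆I v∈J)

  ∈Nbr⁺ : ∀ {v x} → Edge G v x → x ∈ Nbr G v
  ∈Nbr⁺ {v} {x} e = lookup⇒[]= x _ (trans (lookup∘tabulate (adj G v) x) e)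

  ∈Nbr⁻ : ∀ {v x} → x ∈ Nbr G v → Edge G v x
  ∈Nbr⁻ {v} {x} x∈Nv = trans (≡.sym (lookup∘tabulate (adj G v) x)) ([]=⇒lookup x∈Nv)

  ∈ClosedNbrIn⁻ : ∀ {A v x} → x ∈ ClosedNbrIn G A v → x ∈ A × (x ≡ v ⊎ Edge G v x)
  ∈ClosedNbrIn⁻ {A} {v} x∈N with x∈p∩q⁻ A _ x∈N
  ... | x∈A , x∈v∪Nv with x∈p∪q⁻ ⁅ v ⁆ (Nbr G v) x∈v∪Nv
  ...   | inj₁ x∈v  = x∈A , inj₁ (x∈⁅y⁆⇒x≡y v x∈v)
  ...   | inj₂ x∈Nv = x∈A , inj₂ (∈Nbr⁻ x∈Nv)

  ∈ClosedNbrIn⇒ConnectedIn : ∀ {A v x} → v ∈ A → x ∈ ClosedNbrIn G A v → ConnectedIn A x v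
  ∈ClosedNbrIn⇒ConnectedIn v∈A x∈N with ∈ClosedNbrIn⁻ x∈N
  ... | _   , inj₁ refl = ε
  ... | x∈A , inj₂ e    = (x∈A , v∈A , Edge-sym e) ◅ ε

  -- deg a ≤ 1 + ∣ N(v) - a - b ∣ = deg v - 1.
  degIn-< : ∀ {A v a b} → a ∈ A → b ∈ A → Edge G v a → Edge G v b → a ≢ b → ¬ Edge G a b →
            (∀ {u} → u ∈ A → Edge G a u → u ∈ ClosedNbrIn G A v) →
            degIn G A a < degIn G A v
  degIn-< {A} {v} {a} {b} a∈A b∈A va vb a≢b ¬ab Na⊆N[v] = begin-strict
    ∣ A ∩ Nbr G a ∣             ≤⟨ ∣p∣≤1+∣p-x∣ (A ∩ Nbr G a) v ⟩
    suc ∣ A ∩ Nbr G a - v ∣     ≤⟨ s≤s (p⊆q⇒∣p∣≤∣q∣ Na-v⊆Nv-a-b) ⟩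
    suc ∣ A ∩ Nbr G v - a - b ∣ <⟨ s≤s (x∈p⇒∣p-x∣<∣p∣ b∈Nv-a) ⟩
    suc ∣ A ∩ Nbr G v - a ∣     ≤⟨ x∈p⇒∣p-x∣<∣p∣ (x∈p∩q⁺ (a∈A , ∈Nbr⁺ va)) ⟩
    ∣ A ∩ Nbr G v ∣             ∎
    where
    open ≤-Reasoning
    b∈Nv-a : b ∈ A ∩ Nbr G v - a
    b∈Nv-a = x∈p∧x≢y⇒x∈p-y (x∈p∩q⁺ (b∈A , ∈Nbr⁺ vb)) (≢-sym a≢b)
    Na-v⊆Nv-a-b : A ∩ Nbr G a - v ⊆ A ∩ Nbr G v - a - b
    Na-v⊆Nv-a-b {u} u∈Na-v with x∈p∩q⁻ A (Nbr G a) (p─q⊆p _ ⁅ v ⁆ u∈Na-v)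
    ... | u∈A , u∈Na with ∈ClosedNbrIn⁻ (Na⊆N[v] u∈A (∈Nbr⁻ u∈Na))
    ...   | _ , inj₁ u≡v = ⊥-elim (x∉⁅y⁆⇒x≢y (x∈p─q⇒x∉q u∈Na-v) u≡v)
    ...   | _ , inj₂ vu  = x∈p∧x≢y⇒x∈p-y (x∈p∧x≢y⇒x∈p-y (x∈p∩q⁺ (u∈A , ∈Nbr⁺ vu)) u≢a) u≢b
      where
      u≢a : u ≢ a
      u≢a refl = ¬Edge-refl (∈Nbr⁻ u∈Na)
      u≢b : u ≢ b
      u≢b refl = ¬ab (∈Nbr⁻ u∈Na)

  module Step {A : Subset n} {v : Fin n} (v∈A : v ∈ A) where

    N : Subset n
    N = ClosedNbrIn G A v

    A' : Subset n
    A' = A ─ N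

    ConnectedIn-N : ∀ {x y} → x ∈ N → y ∈ N → ConnectedIn A x y
    ConnectedIn-N x∈N y∈N =
      ∈ClosedNbrIn⇒ConnectedIn v∈A x∈N ◅◅ ConnectedIn-sym (∈ClosedNbrIn⇒ConnectedIn v∈A y∈N)

    ∉N? : Decidable (_∉ N)
    ∉N? = ∁? (_∈? N)

    scattered-─N : ∀ {R} → Scattered A R → ∃ λ R' → Scattered A' R' × length R ≤ suc (length R')
    scattered-─N {R} (R⊆A , R-apart) =
      filter ∉N? R ,
      (All.zipWith (λ (x∈A , x∉N) → x∈p∧x∉q⇒x∈p─q x∈A x∉N)
                   (All.filter⁺ ∉N? R⊆A , All.all-filter ∉N? R) ,
       AllPairs.map (λ x⊥y c → x⊥y (ConnectedIn-mono (p─q⊆p A N) c)) (AllPairs.filter⁺ ∉N? R-apart)) ,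
      length≤1+length-filter∁ (_∈? N)
        (AllPairs.map (λ x⊥y x∈N y∈N → x⊥y (ConnectedIn-N x∈N y∈N)) R-apart)

    LeavingEdge : Set
    LeavingEdge = ∃ λ u → ∃ λ w → u ∈ N × w ∈ A' × Edge G u w

    leavingEdge? : Dec LeavingEdge
    leavingEdge? = any? λ u → any? λ w → (u ∈? N) ×-dec (w ∈? A') ×-dec (adj G u w Bool.≟ true)

    module _ {w} (w∈A' : w ∈ A') (w~v : ConnectedIn A w v) where

      relocate : Fin n → Fin n
      relocate x with x ∈? N
      ... | yes _ = w
      ... | no  _ = x

      relocate-∈ : ∀ {x} → x ∈ A → relocate x ∈ A'
      relocate-∈ {x} x∈A with x ∈? N
      ... | yes _   = w∈A'
      ... | no  x∉N = x∈p∧x∉q⇒x∈p─q x∈A x∉N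

      ConnectedIn-relocate : ∀ {x} → ConnectedIn A x (relocate x)
      ConnectedIn-relocate {x} with x ∈? N
      ... | yes x∈N = ∈ClosedNbrIn⇒ConnectedIn v∈A x∈N ◅◅ ConnectedIn-sym w~v
      ... | no  _   = ε

      Apart-relocate : ∀ {x y} → Apart A x y → Apart A' (relocate x) (relocate y)
      Apart-relocate x⊥y c =
        x⊥y (ConnectedIn-relocate ◅◅ ConnectedIn-mono (p─q⊆p A N) c ◅◅ ConnectedIn-sym ConnectedIn-relocate)

    leaving⇒scattered : LeavingEdge → ∀ {R} → Scattered A R →
                        ∃ λ R' → Scattered A' R' × length R ≤ length R'
    leaving⇒scattered (u , w , u∈N , w∈A' , uw) {R} (R⊆A , R-apart) =
      map (relocate w∈A' w~v) R ,
      (All.map⁺ (All.map (relocate-∈ w∈A' w~v) R⊆A) ,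
       AllPairs.map⁺ (AllPairs.map (Apart-relocate w∈A' w~v) R-apart)) ,
      ≤-reflexive (≡.sym (length-map (relocate w∈A' w~v) R))
      where
      w~v : ConnectedIn A w v
      w~v = (p─q⊆p A N w∈A' , proj₁ (∈ClosedNbrIn⁻ u∈N) , Edge-sym uw) ◅ ∈ClosedNbrIn⇒ConnectedIn v∈A u∈N

    module _ (no-leaving : ¬ LeavingEdge) (min-deg : ∀ u → u ∈ A → degIn G A v ≤ degIn G A u)
             {J} (J-indep : Independent G J) where

      N-closed : ∀ {a u} → a ∈ N → u ∈ A → Edge G a u → u ∈ N
      N-closed {a} {u} a∈N u∈A e =
        decidable-stable (u ∈? N) (λ u∉N → no-leaving (a , u , a∈N , x∈p∧x∉q⇒x∈p─q u∈A u∉N , e))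

      adjacent-to-v : ∀ {a b} → a ∈ N → b ∈ N → a ∈ J → b ∈ J → a ≢ b → Edge G v a
      adjacent-to-v a∈N b∈N a∈J b∈J a≢b with ∈ClosedNbrIn⁻ a∈N | ∈ClosedNbrIn⁻ b∈N
      ... | _ , inj₂ va    | _ = va
      ... | _ , inj₁ refl | _ , inj₁ refl = ⊥-elim (a≢b refl)
      ... | _ , inj₁ refl | _ , inj₂ vb   = ⊥-elim (J-indep _ _ a∈J b∈J vb)

      ∣N∩J∣≤1 : ∣ N ∩ J ∣ ≤ 1
      ∣N∩J∣≤1 = subsingleton⇒∣p∣≤1 (N ∩ J) unique
        where
        unique : ∀ {a b} → a ∈ N ∩ J → b ∈ N ∩ J → a ≡ b
        unique {a} {b} a∈N∩J b∈N∩J = decidable-stable (a Fin.≟ b) λ a≢b →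
          let a∈N , a∈J = x∈p∩q⁻ N J a∈N∩J
              b∈N , b∈J = x∈p∩q⁻ N J b∈N∩J
              a∈A = proj₁ (∈ClosedNbrIn⁻ a∈N)
          in  <-irrefl refl (<-≤-trans
                (degIn-< a∈A (proj₁ (∈ClosedNbrIn⁻ b∈N))
                   (adjacent-to-v a∈N b∈N a∈J b∈J a≢b)
                   (adjacent-to-v b∈N a∈N b∈J a∈J (≢-sym a≢b))
                   a≢b (J-indep a b a∈J b∈J) (N-closed a∈N))
                (min-deg a a∈A))

  moves₀₁ : Subset n → Subset n → List (Fin n) → ℕ
  moves₀₁ A J vs = moves G 0 A J vs + moves G 1 A J vs

  scattered≤moves₀₁ : ∀ {A J vs R} → GreedyRun G A vs → Independent G J → Scattered A R →
                      length R ≤ moves₀₁ A J vs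
  scattered≤moves₀₁ (done A-empty) _ ([] , _)          = z≤n
  scattered≤moves₀₁ (done A-empty) _ ((x∈A ∷ _) , _)   = ⊥-elim (A-empty _ x∈A)
  scattered≤moves₀₁ {A} {J} {v ∷ vs} {R} (step v∈A min-deg run) J-indep R-scattered =
    subst (length R ≤_) (≡.sym moves₀₁-step) bound
    where
    open Step v∈A
    c : ℕ
    c = ∣ N ∩ J ∣
    counted : ℕ
    counted = isMove 0 c + isMove 1 c
    moves₀₁-step : moves₀₁ A J (v ∷ vs) ≡ counted + moves₀₁ A' (J ─ N) vs
    moves₀₁-step = interchange +-commutativeSemigroup
      (isMove 0 c) (moves G 0 A' (J ─ N) vs) (isMove 1 c) (moves G 1 A' (J ─ N) vs)
    ih : ∀ {R'} → Scattered A' R' → length R' ≤ moves₀₁ A' (J ─ N) vs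
    ih = scattered≤moves₀₁ run (Independent-mono (p─q⊆p J N) J-indep)
    bound : length R ≤ counted + moves₀₁ A' (J ─ N) vs
    bound with leavingEdge?
    ... | yes leaving =
      let R' , R'-scattered , R≤R' = leaving⇒scattered leaving R-scattered
      in  ≤-trans R≤R' (≤-trans (ih R'-scattered) (m≤n+m _ counted))
    ... | no no-leaving =
      let R' , R'-scattered , R≤1+R' = scattered-─N R-scattered
          counted≡1 = c≤1⇒isMove₀+isMove₁≡1 c (∣N∩J∣≤1 no-leaving min-deg J-indep)
      in  ≤-trans R≤1+R' (+-mono-≤ (≤-reflexive (≡.sym counted≡1)) (ih R'-scattered))

  components⇒scattered : ∀ {k} → HasComponents G k → ∃ λ R → length R ≡ k × Scattered ⊤ R
  components⇒scattered {k} (comp , comp-onto , comp-connected) =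
    tabulate rep , length-tabulate rep , All.tabulate⁺ (λ _ → ∈⊤) , AllPairs.tabulate⁺ reps-apart
    where
    rep : Fin k → Fin n
    rep i = proj₁ (comp-onto i)
    reps-apart : ∀ {i j} → i ≢ j → Apart ⊤ (rep i) (rep j)
    reps-apart {i} {j} i≢j c = i≢j (begin
      i              ≡⟨ proj₂ (comp-onto i) refl ⟨
      comp (rep i)   ≡⟨ proj₂ (comp-connected (rep i) (rep j)) (Star.map (λ (_ , _ , e) → e) c) ⟩
      comp (rep j)   ≡⟨ proj₂ (comp-onto j) refl ⟩
      j              ∎)
      where open ≡.≡-Reasoning

lemma3 : ∀ {n} (G : Graph n) → Chordal G →
         (I : Subset n) → Independent G I →
         (k : ℕ) → HasComponents G k →
         (vs : List (Fin n)) → GreedyRun G ⊤ vs →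
         k ≤ moves G 0 ⊤ I vs + moves G 1 ⊤ I vs
lemma3 G _ I I-indep k components vs run =
  let R , length-R≡k , R-scattered = components⇒scattered G components
  in  subst (_≤ moves₀₁ G ⊤ I vs) length-R≡k (scattered≤moves₀₁ G run I-indep R-scattered)
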